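{- Every directed co-graph and every extended directed co-graph is a perfect digraph.
   Context: For a digraph $G=(V,E)$, $\vec{\chi}(G)$ is the least $r$ such that $V$ can be partitioned into $r$ sets each inducing a subdigraph without directed cycles, and $\omega_d(G)$ is the number of vertices of a largest subdigraph of $G$ in which every pair of distinct vertices is joined by arcs in both directions. $G$ is perfect if $\vec{\chi}(H)=\omega_d(H)$ for every induced subdigraph $H$ of $G$. For vertex-disjoint digraphs $G_1=(V_1,E_1)$, $G_2=(V_2,E_2)$: the disjoint union $G_1\oplus G_2$ has vertex set $V_1\cup V_2$ and arc set $E_1\cup E_2$; the series composition adds all arcs in both directions between $V_1$ and $V_2$; the order composition adds all arcs from $V_1$ to $V_2$; a directed union is any digraph that is a subdigraph of the order composition and contains the disjoint union. Directed co-graphs are obtained from single-vertex digraphs by disjoint union, series composition and order composition; extended directed co-graphs are obtained from single-vertex digraphs by directed union and series composition. -}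

module Defs where

open import Data.Nat using (ℕ; zero; suc; _+_; _≤_)
open import Data.Fin using (Fin; zero; suc; inject₁; fromℕ; splitAt)
open import Data.Bool using (Bool; true; false; T)
open import Data.Sum using (_⊎_; inj₁; inj₂)
open import Data.Product using (Σ; _×_; _,_)
open import Data.Empty using (⊥)
open import Relation.Nullary using (¬_)
open import Relation.Binary.PropositionalEquality using (_≡_)
open import Function.Definitions using (Injective)

record Digraph : Set where
  field
    n   : ℕ
    arc : Fin n → Fin n → Bool
open Digraph public

-- Induced subdigraphs: the subdigraph induced on the image of an
-- injective map f : Fin m → Fin (n G) (relabelled by Fin m).

pullback : (G : Digraph) {m : ℕ} → (Fin m → Fin (n G)) → Digraph
pullback G {m} f = record { n = m ; arc = λ i j → arc G (f i) (f j) }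

-- Directed cycles inside a vertex set P: distinct vertices
-- c 0, c 1, ..., c (k+1)  (length ≥ 2) all in P, with arcs
-- c i → c (i+1) and c (k+1) → c 0.

record DirectedCycleIn (G : Digraph) (P : Fin (n G) → Set) : Set where
  field
    len   : ℕ
    c     : Fin (suc (suc len)) → Fin (n G)
    inj   : Injective _≡_ _≡_ c
    inP   : ∀ i → P (c i)
    step  : ∀ (i : Fin (suc len)) → T (arc G (c (inject₁ i)) (c (suc i)))
    close : T (arc G (c (fromℕ (suc len))) (c zero))

AcyclicSet : (G : Digraph) → (Fin (n G) → Set) → Set
AcyclicSet G P = ¬ DirectedCycleIn G P

AcyclicColourable : Digraph → ℕ → Set
AcyclicColourable G r =
  Σ (Fin (n G) → Fin r) λ col →
    ∀ (a : Fin r) → AcyclicSet G (λ v → col v ≡ a)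

IsDichromaticNumber : Digraph → ℕ → Set
IsDichromaticNumber G r =
  AcyclicColourable G r × (∀ s → AcyclicColourable G s → r ≤ s)

HasBiClique : Digraph → ℕ → Set
HasBiClique G k =
  Σ (Fin k → Fin (n G)) λ c →
    Injective _≡_ _≡_ c × (∀ i j → ¬ i ≡ j → T (arc G (c i) (c j)))

IsBiCliqueNumber : Digraph → ℕ → Set
IsBiCliqueNumber G w = HasBiClique G w × (∀ k → HasBiClique G k → k ≤ w)

Perfect : Digraph → Set
Perfect G =
  ∀ (m : ℕ) (f : Fin m → Fin (n G)) → Injective _≡_ _≡_ f →
    Σ ℕ λ r → IsDichromaticNumber (pullback G f) r
            × IsBiCliqueNumber (pullback G f) r

-- Compositions.  Vertex set of the composite is Fin (n G₁ + n G₂),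
-- the first n G₁ vertices being V₁ and the rest V₂ (via splitAt).

combine : {m k : ℕ} → (Fin m → Fin m → Bool) → (Fin k → Fin k → Bool) →
          Bool → Bool → Fin m ⊎ Fin k → Fin m ⊎ Fin k → Bool
combine a₁ a₂ x y (inj₁ u) (inj₁ v) = a₁ u v
combine a₁ a₂ x y (inj₂ u) (inj₂ v) = a₂ u v
combine a₁ a₂ x y (inj₁ u) (inj₂ v) = x
combine a₁ a₂ x y (inj₂ u) (inj₁ v) = y

compose : Bool → Bool → Digraph → Digraph → Digraph
compose x y G₁ G₂ = record
  { n   = n G₁ + n G₂
  ; arc = λ u v → combine (arc G₁) (arc G₂) x y
                    (splitAt (n G₁) u) (splitAt (n G₁) v) }

single : Digraph
single = record { n = 1 ; arc = λ _ _ → false }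

_⊕_ : Digraph → Digraph → Digraph
_⊕_ = compose false false

_⊗_ : Digraph → Digraph → Digraph
_⊗_ = compose true true

_⊘_ : Digraph → Digraph → Digraph
_⊘_ = compose true false

IsDirectedUnion : (G₁ G₂ : Digraph) → (Fin (n G₁ + n G₂) → Fin (n G₁ + n G₂) → Bool) → Set
IsDirectedUnion G₁ G₂ A =
    (∀ u v → T (arc (G₁ ⊕ G₂) u v) → T (A u v))
  × (∀ u v → T (A u v) → T (arc (G₁ ⊘ G₂) u v))

data DirectedCograph : Digraph → Set where
  dc-single : DirectedCograph single
  dc-union  : ∀ {G₁ G₂} → DirectedCograph G₁ → DirectedCograph G₂ →
              DirectedCograph (G₁ ⊕ G₂)
  dc-series : ∀ {G₁ G₂} → DirectedCograph G₁ → DirectedCograph G₂ →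
              DirectedCograph (G₁ ⊗ G₂)
  dc-order  : ∀ {G₁ G₂} → DirectedCograph G₁ → DirectedCograph G₂ →
              DirectedCograph (G₁ ⊘ G₂)

data ExtDirectedCograph : Digraph → Set where
  edc-single : ExtDirectedCograph single
  edc-dunion : ∀ {G₁ G₂ A} → ExtDirectedCograph G₁ → ExtDirectedCograph G₂ →
               IsDirectedUnion G₁ G₂ A →
               ExtDirectedCograph (record { n = n G₁ + n G₂ ; arc = A })
  edc-series : ∀ {G₁ G₂} → ExtDirectedCograph G₁ → ExtDirectedCograph G₂ →
               ExtDirectedCograph (G₁ ⊗ G₂)

{-# OPTIONS --safe #-}
-- Induction on the construction proves a hereditary strengthening: every decidable vertex set P
-- carries a bi-clique and an acyclic colouring of P of the same size r, which forces r = χ⃗ = ω_d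
-- on the subdigraph induced by P. In a directed union no arc goes back from V₂ to V₁, so every
-- cycle stays on one side, both sides may share a palette, and the larger bi-clique suffices.
-- In a series composition the two bi-cliques join into one, and disjoint palettes keep every
-- colour class on one side, so both sizes add.
module Submission where

open import Data.Bool using (Bool; true; false; T)
open import Data.Empty using (⊥; ⊥-elim)
open import Data.Fin using (Fin; zero; suc; toℕ; fromℕ<; inject₁; splitAt; join; _↑ˡ_; _↑ʳ_)
open import Data.Fin.Induction using (<-weakInduction; <-weakInduction-startingFrom)
open import Data.Fin.Properties
  using (_≟_; any?; ≤fromℕ; toℕ-fromℕ<; splitAt-join; join-splitAt; splitAt⁻¹-↑ˡ; splitAt⁻¹-↑ʳ;
         ↑ˡ-injective; ↑ʳ-injective; injective⇒≤)
open import Data.Nat using (ℕ; _+_; _≤_; _<_; z≤n; s≤s)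
open import Data.Nat.Properties using (≤-total; ≤-refl; <-≤-trans; m≤m+n; +-monoʳ-<; +-cancelˡ-≡; <⇒≱)
open import Data.Product using (∃; _×_; _,_; proj₁; proj₂)
open import Data.Sum using (_⊎_; inj₁; inj₂; [_,_]′)
open import Function using (_∘_; id)
open import Function.Definitions using (Injective)
open import Relation.Nullary using (yes; no)
open import Relation.Unary using (Decidable)
open import Relation.Binary.PropositionalEquality using (_≡_; _≢_; refl; sym; trans; cong; subst; subst₂)

open import Defs

digon : ∀ {G P u v} → u ≢ v → T (arc G u v) → T (arc G v u) → P u → P v → DirectedCycleIn G P
digon {G} {P} {u} {v} u≢v uv vu Pu Pv = record
  { len = 0 ; c = vertex ; inj = vertex-injective ; inP = vertex-∈
  ; step = λ { zero → uv } ; close = vu }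
  where
  vertex : Fin 2 → Fin (n G)
  vertex zero       = u
  vertex (suc zero) = v

  vertex-injective : Injective _≡_ _≡_ vertex
  vertex-injective {zero}     {zero}     _ = refl
  vertex-injective {zero}     {suc zero} e = ⊥-elim (u≢v e)
  vertex-injective {suc zero} {zero}     e = ⊥-elim (u≢v (sym e))
  vertex-injective {suc zero} {suc zero} _ = refl

  vertex-∈ : ∀ i → P (vertex i)
  vertex-∈ zero       = Pu
  vertex-∈ (suc zero) = Pv

ForwardClosed : (G : Digraph) → (Fin (n G) → Set) → Set
ForwardClosed G Q = ∀ u v → T (arc G u v) → Q u → Q v

-- Walk forward from c i to the last vertex, close the cycle, then walk forward from c 0.
cycle-closed : ∀ {G P Q} → ForwardClosed G Q → (cy : DirectedCycleIn G P) →
               ∀ i → Q (DirectedCycleIn.c cy i) → ∀ j → Q (DirectedCycleIn.c cy j)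
cycle-closed {Q = Q} closed cy i Qi = <-weakInduction (Q ∘ c) Q-first advance
  where
  open DirectedCycleIn cy

  advance : ∀ j → Q (c (inject₁ j)) → Q (c (suc j))
  advance j = closed _ _ (step j)

  Q-first : Q (c zero)
  Q-first = closed _ _ close (<-weakInduction-startingFrom (Q ∘ c) Qi advance (≤fromℕ i))

mapCycle : ∀ {G H P Q} (f : Fin (n G) → Fin (n H)) → Injective _≡_ _≡_ f →
           (∀ u v → T (arc G u v) → T (arc H (f u) (f v))) → (∀ v → P v → Q (f v)) →
           DirectedCycleIn G P → DirectedCycleIn H Q
mapCycle f f-injective f-arc f-∈ cy = record
  { len = len ; c = f ∘ c ; inj = λ e → inj (f-injective e) ; inP = λ i → f-∈ _ (inP i)
  ; step = λ i → f-arc _ _ (step i) ; close = f-arc _ _ close }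
  where open DirectedCycleIn cy

pullCycle : ∀ {G H P Q} (e : Fin (n G) → Fin (n H)) → Injective _≡_ _≡_ e →
            (∀ u v → T (arc H (e u) (e v)) → T (arc G u v)) → (∀ u → Q (e u) → P u) →
            (cy : DirectedCycleIn H Q) → (∀ i → ∃ λ u → e u ≡ DirectedCycleIn.c cy i) →
            DirectedCycleIn G P
pullCycle {G} {H} {Q = Q} e e-injective e-arc e-∈ cy preimage = record
  { len = len ; c = c′ ; inj = λ eq → inj (trans (sym (lifts _)) (trans (cong e eq) (lifts _)))
  ; inP = λ i → e-∈ _ (subst Q (sym (lifts i)) (inP i))
  ; step = λ i → e-arc _ _ (pull (step i)) ; close = e-arc _ _ (pull close) }
  where
  open DirectedCycleIn cy

  c′ : Fin (2 + len) → Fin (n G)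
  c′ i = proj₁ (preimage i)

  lifts : ∀ i → e (c′ i) ≡ c i
  lifts i = proj₂ (preimage i)

  pull : ∀ {i j} → T (arc H (c i) (c j)) → T (arc H (e (c′ i)) (e (c′ j)))
  pull = subst₂ (λ u v → T (arc H u v)) (sym (lifts _)) (sym (lifts _))

record BiCliqueIn (G : Digraph) (P : Fin (n G) → Set) (k : ℕ) : Set where
  field
    vertex           : Fin k → Fin (n G)
    vertex-injective : Injective _≡_ _≡_ vertex
    vertex-∈         : ∀ i → P (vertex i)
    arcs             : ∀ i j → i ≢ j → T (arc G (vertex i) (vertex j))

-- Colours are naturals, bounded only on P: a colouring into Fin 0 would not exist when P is empty but G is not.
record AcyclicColouringOn (G : Digraph) (P : Fin (n G) → Set) (r : ℕ) : Set where
  field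
    colour   : Fin (n G) → ℕ
    colour-< : ∀ v → P v → colour v < r
    acyclic  : ∀ a → AcyclicSet G (λ v → P v × colour v ≡ a)

Tight : (G : Digraph) → (Fin (n G) → Set) → Set
Tight G P = ∃ λ r → BiCliqueIn G P r × AcyclicColouringOn G P r

HereditarilyTight : Digraph → Set₁
HereditarilyTight G = ∀ P → Decidable P → Tight G P

mapBiClique : ∀ {G H P Q k} (f : Fin (n G) → Fin (n H)) → Injective _≡_ _≡_ f →
              (∀ u v → T (arc G u v) → T (arc H (f u) (f v))) → (∀ v → P v → Q (f v)) →
              BiCliqueIn G P k → BiCliqueIn H Q k
mapBiClique f f-injective f-arc f-∈ K = record
  { vertex = f ∘ vertex ; vertex-injective = λ e → vertex-injective (f-injective e)
  ; vertex-∈ = λ i → f-∈ _ (vertex-∈ i) ; arcs = λ i j i≢j → f-arc _ _ (arcs i j i≢j) }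
  where open BiCliqueIn K

-- Two clique vertices of the same colour would form a monochromatic digon.
biClique≤colours : ∀ {G k s} → HasBiClique G k → AcyclicColourable G s → k ≤ s
biClique≤colours (c , c-injective , c-arc) (col , acyclic) = injective⇒≤ col∘c-injective
  where
  col∘c-injective : Injective _≡_ _≡_ (col ∘ c)
  col∘c-injective {i} {j} same with i ≟ j
  ... | yes i≡j = i≡j
  ... | no  i≢j = ⊥-elim (acyclic (col (c i))
                    (digon (i≢j ∘ c-injective) (c-arc i j i≢j) (c-arc j i (i≢j ∘ sym)) refl (sym same)))

equalSizes⇒χ≡ω : ∀ {G r} → HasBiClique G r → AcyclicColourable G r →
                 IsDichromaticNumber G r × IsBiCliqueNumber G r
equalSizes⇒χ≡ω clique colouring =
  (colouring , λ _ → biClique≤colours clique) , (clique , λ _ k-clique → biClique≤colours k-clique colouring)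

Image : ∀ {A B : Set} → (A → B) → B → Set
Image f v = ∃ λ i → f i ≡ v

module _ {G : Digraph} {m : ℕ} {f : Fin m → Fin (n G)} (f-injective : Injective _≡_ _≡_ f) where

  pullBiClique : ∀ {r} → BiCliqueIn G (Image f) r → HasBiClique (pullback G f) r
  pullBiClique {r} K = vertex′ , vertex′-injective , vertex′-arcs
    where
    open BiCliqueIn K

    vertex′ : Fin r → Fin m
    vertex′ i = proj₁ (vertex-∈ i)

    lifts : ∀ i → f (vertex′ i) ≡ vertex i
    lifts i = proj₂ (vertex-∈ i)

    vertex′-injective : Injective _≡_ _≡_ vertex′
    vertex′-injective e = vertex-injective (trans (sym (lifts _)) (trans (cong f e) (lifts _)))

    vertex′-arcs : ∀ i j → i ≢ j → T (arc G (f (vertex′ i)) (f (vertex′ j)))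
    vertex′-arcs i j i≢j = subst₂ (λ u v → T (arc G u v)) (sym (lifts i)) (sym (lifts j)) (arcs i j i≢j)

  pullColouring : ∀ {r} → AcyclicColouringOn G (Image f) r → AcyclicColourable (pullback G f) r
  pullColouring {r} C = colour′ , λ a cy → acyclic (toℕ a) (mapCycle f f-injective (λ _ _ uv → uv) (colour′-∈ a) cy)
    where
    open AcyclicColouringOn C

    colour′ : Fin m → Fin r
    colour′ i = fromℕ< (colour-< (f i) (i , refl))

    colour′-∈ : ∀ a i → colour′ i ≡ a → Image f (f i) × colour (f i) ≡ toℕ a
    colour′-∈ a i e = (i , refl) , trans (sym (toℕ-fromℕ< _)) (cong toℕ e)

hereditarilyTight⇒perfect : ∀ {G} → HereditarilyTight G → Perfect G
hereditarilyTight⇒perfect tight m f f-injective with tight (Image f) (λ v → any? (λ i → f i ≟ v))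
... | r , K , C = r , equalSizes⇒χ≡ω (pullBiClique f-injective K) (pullColouring f-injective C)

single-acyclic : ∀ {P} → AcyclicSet single P
single-acyclic cy = DirectedCycleIn.step cy zero

single-tight : HereditarilyTight single
single-tight P P? with P? zero
... | yes P0 = 1 , clique , record { colour = λ _ → 0 ; colour-< = λ _ _ → s≤s z≤n ; acyclic = λ _ → single-acyclic }
  where
  clique : BiCliqueIn single P 1
  clique = record { vertex = id ; vertex-injective = id ; vertex-∈ = λ { zero → P0 }
                  ; arcs = λ { zero zero 0≢0 → ⊥-elim (0≢0 refl) } }
... | no ¬P0 = 0 , clique , record { colour = λ _ → 0 ; colour-< = λ { zero P0 → ⊥-elim (¬P0 P0) }
                                  ; acyclic = λ _ → single-acyclic }
  where
  clique : BiCliqueIn single P 0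
  clique = record { vertex = λ () ; vertex-injective = λ { {()} } ; vertex-∈ = λ () ; arcs = λ () }

arc-compose-join : ∀ x y G₁ G₂ s t →
                   arc (compose x y G₁ G₂) (join (n G₁) (n G₂) s) (join (n G₁) (n G₂) t)
                   ≡ combine (arc G₁) (arc G₂) x y s t
arc-compose-join x y G₁ G₂ s t rewrite splitAt-join (n G₁) (n G₂) s | splitAt-join (n G₁) (n G₂) t = refl

record InducesSummands (G₁ G₂ : Digraph) (A : Fin (n G₁ + n G₂) → Fin (n G₁ + n G₂) → Bool) : Set where
  field
    left-preserves  : ∀ x y → T (arc G₁ x y) → T (A (x ↑ˡ n G₂) (y ↑ˡ n G₂))
    left-reflects   : ∀ x y → T (A (x ↑ˡ n G₂) (y ↑ˡ n G₂)) → T (arc G₁ x y)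
    right-preserves : ∀ x y → T (arc G₂ x y) → T (A (n G₁ ↑ʳ x) (n G₁ ↑ʳ y))
    right-reflects  : ∀ x y → T (A (n G₁ ↑ʳ x) (n G₁ ↑ʳ y)) → T (arc G₂ x y)

compose-inducesSummands : ∀ x y G₁ G₂ → InducesSummands G₁ G₂ (arc (compose x y G₁ G₂))
compose-inducesSummands x y G₁ G₂ = record
  { left-preserves  = λ u v → subst T (sym (arc-compose-join x y G₁ G₂ (inj₁ u) (inj₁ v)))
  ; left-reflects   = λ u v → subst T (arc-compose-join x y G₁ G₂ (inj₁ u) (inj₁ v))
  ; right-preserves = λ u v → subst T (sym (arc-compose-join x y G₁ G₂ (inj₂ u) (inj₂ v)))
  ; right-reflects  = λ u v → subst T (arc-compose-join x y G₁ G₂ (inj₂ u) (inj₂ v)) }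

module Composite {G₁ G₂ A} (summands : InducesSummands G₁ G₂ A) (P : Fin (n G₁ + n G₂) → Set) where
  open InducesSummands summands

  H : Digraph
  H = record { n = n G₁ + n G₂ ; arc = A }

  P₁ : Fin (n G₁) → Set
  P₁ = P ∘ (_↑ˡ n G₂)

  P₂ : Fin (n G₂) → Set
  P₂ = P ∘ (n G₁ ↑ʳ_)

  Left Right : Fin (n G₁ + n G₂) → Set
  Left  v = ∃ λ x → x ↑ˡ n G₂ ≡ v
  Right v = ∃ λ y → n G₁ ↑ʳ y ≡ v

  side : ∀ v → Left v ⊎ Right v
  side v with splitAt (n G₁) v in eq
  ... | inj₁ x = inj₁ (x , splitAt⁻¹-↑ˡ eq)
  ... | inj₂ y = inj₂ (y , splitAt⁻¹-↑ʳ eq)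

  left∩right-empty : ∀ {v} → Left v → Right v → ⊥
  left∩right-empty (x , refl) (y , e) with () ← trans (sym (splitAt-join (n G₁) (n G₂) (inj₂ y)))
                                                 (trans (cong (splitAt (n G₁)) e) (splitAt-join (n G₁) (n G₂) (inj₁ x)))

  OneSided : ∀ {Q} → DirectedCycleIn H Q → Set
  OneSided cy = (∀ i → Left (c i)) ⊎ (∀ i → Right (c i))
    where open DirectedCycleIn cy

  oneSided-if-separated : ∀ {Q} → (∀ {u v} → Q u → Q v → Left u → Right v → ⊥) →
                          (cy : DirectedCycleIn H Q) → OneSided cy
  oneSided-if-separated separated cy =
    [ (λ l → inj₁ λ i → [ id , (λ r → ⊥-elim (separated (inP zero) (inP i) l r)) ]′ (side (c i)))
    , (λ r → inj₂ λ i → [ (λ l → ⊥-elim (separated (inP i) (inP zero) l r)) , id ]′ (side (c i)))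
    ]′ (side (c zero))
    where open DirectedCycleIn cy

  liftLeft : ∀ {r} → BiCliqueIn G₁ P₁ r → BiCliqueIn H P r
  liftLeft = mapBiClique (_↑ˡ n G₂) (↑ˡ-injective _ _ _) left-preserves (λ _ p → p)

  liftRight : ∀ {r} → BiCliqueIn G₂ P₂ r → BiCliqueIn H P r
  liftRight = mapBiClique (n G₁ ↑ʳ_) (↑ʳ-injective _ _ _) right-preserves (λ _ p → p)

  module Colouring {r₁ r₂} (C₁ : AcyclicColouringOn G₁ P₁ r₁) (C₂ : AcyclicColouringOn G₂ P₂ r₂)
                   (offset : ℕ) where
    open AcyclicColouringOn C₁ renaming (colour to colour₁; colour-< to colour₁-<; acyclic to acyclic₁)
    open AcyclicColouringOn C₂ renaming (colour to colour₂; colour-< to colour₂-<; acyclic to acyclic₂)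

    colour : Fin (n G₁ + n G₂) → ℕ
    colour v = [ colour₁ , (offset +_) ∘ colour₂ ]′ (splitAt (n G₁) v)

    colour-left : ∀ x → colour (x ↑ˡ n G₂) ≡ colour₁ x
    colour-left x = cong [ colour₁ , (offset +_) ∘ colour₂ ]′ (splitAt-join (n G₁) (n G₂) (inj₁ x))

    colour-right : ∀ y → colour (n G₁ ↑ʳ y) ≡ offset + colour₂ y
    colour-right y = cong [ colour₁ , (offset +_) ∘ colour₂ ]′ (splitAt-join (n G₁) (n G₂) (inj₂ y))

    colour-< : ∀ {s} → r₁ ≤ s → offset + r₂ ≤ s → ∀ v → P v → colour v < s
    colour-< {s} r₁≤s r₂≤s v Pv with side v
    ... | inj₁ (x , refl) = subst (_< s) (sym (colour-left x)) (<-≤-trans (colour₁-< x Pv) r₁≤s)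
    ... | inj₂ (y , refl) = subst (_< s) (sym (colour-right y)) (<-≤-trans (+-monoʳ-< offset (colour₂-< y Pv)) r₂≤s)

    Monochromatic : ℕ → Fin (n G₁ + n G₂) → Set
    Monochromatic a v = P v × colour v ≡ a

    no-oneSided-cycle : ∀ a (cy : DirectedCycleIn H (Monochromatic a)) → OneSided cy → ⊥
    no-oneSided-cycle a cy (inj₁ left) =
      acyclic₁ a (pullCycle (_↑ˡ n G₂) (↑ˡ-injective _ _ _) left-reflects
                   (λ x (Px , e) → Px , trans (sym (colour-left x)) e) cy left)
    no-oneSided-cycle a cy (inj₂ right) =
      acyclic₂ (colour₂ y₀) (pullCycle (n G₁ ↑ʳ_) (↑ʳ-injective _ _ _) right-reflects
                               (λ y (Py , e) → Py , +-cancelˡ-≡ offset _ _ (trans (sym (colour-right y)) (trans e (sym a≡))))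
                               cy right)
      where
      open DirectedCycleIn cy
      y₀ : Fin (n G₂)
      y₀ = proj₁ (right zero)
      a≡ : offset + colour₂ y₀ ≡ a
      a≡ = trans (sym (colour-right y₀)) (trans (cong colour (proj₂ (right zero))) (proj₂ (inP zero)))

    colouring : ∀ {s} → r₁ ≤ s → offset + r₂ ≤ s → (∀ a (cy : DirectedCycleIn H (Monochromatic a)) → OneSided cy) →
                AcyclicColouringOn H P s
    colouring r₁≤s r₂≤s oneSided = record
      { colour = colour ; colour-< = colour-< r₁≤s r₂≤s
      ; acyclic = λ a cy → no-oneSided-cycle a cy (oneSided a cy) }

module _ {G₁ G₂ A} (union : IsDirectedUnion G₁ G₂ A) where

  directedUnion-inducesSummands : InducesSummands G₁ G₂ A
  directedUnion-inducesSummands = record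
    { left-preserves  = λ x y → proj₁ union _ _ ∘ ⊕.left-preserves x y
    ; left-reflects   = λ x y → ⊘.left-reflects x y ∘ proj₂ union _ _
    ; right-preserves = λ x y → proj₁ union _ _ ∘ ⊕.right-preserves x y
    ; right-reflects  = λ x y → ⊘.right-reflects x y ∘ proj₂ union _ _ }
    where
    module ⊕ = InducesSummands (compose-inducesSummands false false G₁ G₂)
    module ⊘ = InducesSummands (compose-inducesSummands true false G₁ G₂)

  module _ (P : Fin (n G₁ + n G₂) → Set) where
    open Composite directedUnion-inducesSummands P

    right-forwardClosed : ForwardClosed H Right
    right-forwardClosed u v uv (y , refl) with side v
    ... | inj₂ right = right
    ... | inj₁ (x , refl) = ⊥-elim (subst T (arc-compose-join true false G₁ G₂ (inj₂ y) (inj₁ x)) (proj₂ union _ _ uv))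

    -- A cycle that enters V₂ can never come back to V₁.
    directedUnion-oneSided : ∀ {Q} (cy : DirectedCycleIn H Q) → OneSided cy
    directedUnion-oneSided cy = [ allLeft , (λ r → inj₂ (cycle-closed right-forwardClosed cy zero r)) ]′ (side (c zero))
      where
      open DirectedCycleIn cy
      allLeft : Left (c zero) → OneSided cy
      allLeft l = inj₁ λ i → [ id , (λ r → ⊥-elim (left∩right-empty l (cycle-closed right-forwardClosed cy i r zero))) ]′ (side (c i))

  directedUnion-tight : HereditarilyTight G₁ → HereditarilyTight G₂ → HereditarilyTight (record { n = n G₁ + n G₂ ; arc = A })
  directedUnion-tight tight₁ tight₂ P P? with tight₁ _ (P? ∘ (_↑ˡ n G₂)) | tight₂ _ (P? ∘ (n G₁ ↑ʳ_))
  ... | r₁ , K₁ , C₁ | r₂ , K₂ , C₂ = larger (≤-total r₁ r₂)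
    where
    open Composite directedUnion-inducesSummands P
    open Colouring C₁ C₂ 0

    larger : r₁ ≤ r₂ ⊎ r₂ ≤ r₁ → Tight H P
    larger (inj₁ r₁≤r₂) = r₂ , liftRight K₂ , colouring r₁≤r₂ ≤-refl (λ _ → directedUnion-oneSided P)
    larger (inj₂ r₂≤r₁) = r₁ , liftLeft K₁ , colouring ≤-refl r₂≤r₁ (λ _ → directedUnion-oneSided P)

module _ {G₁ G₂ : Digraph} (P : Fin (n G₁ + n G₂) → Set) where
  open InducesSummands (compose-inducesSummands true true G₁ G₂)
  open Composite (compose-inducesSummands true true G₁ G₂) P

  joinBiCliques : ∀ {r₁ r₂} → BiCliqueIn G₁ P₁ r₁ → BiCliqueIn G₂ P₂ r₂ → BiCliqueIn (G₁ ⊗ G₂) P (r₁ + r₂)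
  joinBiCliques {r₁} {r₂} K₁ K₂ = record
    { vertex = vertex⊎ ∘ splitAt r₁
    ; vertex-injective = splitAt-injective ∘ vertex⊎-injective
    ; vertex-∈ = vertex⊎-∈ ∘ splitAt r₁
    ; arcs = λ i j i≢j → vertex⊎-arcs _ _ (i≢j ∘ splitAt-injective) }
    where
    module K₁ = BiCliqueIn K₁
    module K₂ = BiCliqueIn K₂

    vertex⊎ : Fin r₁ ⊎ Fin r₂ → Fin (n G₁ + n G₂)
    vertex⊎ (inj₁ i) = K₁.vertex i ↑ˡ n G₂
    vertex⊎ (inj₂ j) = n G₁ ↑ʳ K₂.vertex j

    vertex⊎-injective : Injective _≡_ _≡_ vertex⊎
    vertex⊎-injective {inj₁ i} {inj₁ j} e = cong inj₁ (K₁.vertex-injective (↑ˡ-injective _ _ _ e))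
    vertex⊎-injective {inj₂ i} {inj₂ j} e = cong inj₂ (K₂.vertex-injective (↑ʳ-injective _ _ _ e))
    vertex⊎-injective {inj₁ i} {inj₂ j} e = ⊥-elim (left∩right-empty (_ , e) (_ , refl))
    vertex⊎-injective {inj₂ i} {inj₁ j} e = ⊥-elim (left∩right-empty (_ , refl) (_ , e))

    splitAt-injective : Injective _≡_ _≡_ (splitAt r₁ {r₂})
    splitAt-injective {i} {j} e = trans (sym (join-splitAt r₁ r₂ i)) (trans (cong (join r₁ r₂) e) (join-splitAt r₁ r₂ j))

    vertex⊎-∈ : ∀ s → P (vertex⊎ s)
    vertex⊎-∈ (inj₁ i) = K₁.vertex-∈ i
    vertex⊎-∈ (inj₂ j) = K₂.vertex-∈ j

    vertex⊎-arcs : ∀ s t → s ≢ t → T (arc (G₁ ⊗ G₂) (vertex⊎ s) (vertex⊎ t))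
    vertex⊎-arcs (inj₁ i) (inj₁ j) s≢t = left-preserves _ _ (K₁.arcs i j (s≢t ∘ cong inj₁))
    vertex⊎-arcs (inj₂ i) (inj₂ j) s≢t = right-preserves _ _ (K₂.arcs i j (s≢t ∘ cong inj₂))
    vertex⊎-arcs (inj₁ i) (inj₂ j) _ = subst T (sym (arc-compose-join true true G₁ G₂ (inj₁ _) (inj₂ _))) _
    vertex⊎-arcs (inj₂ i) (inj₁ j) _ = subst T (sym (arc-compose-join true true G₁ G₂ (inj₂ _) (inj₁ _))) _

  -- With the colours of V₂ shifted past those of V₁, every colour class lies on one side.
  module _ {r₁ r₂} (C₁ : AcyclicColouringOn G₁ P₁ r₁) (C₂ : AcyclicColouringOn G₂ P₂ r₂) where
    open Colouring C₁ C₂ r₁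

    series-oneSided : ∀ a (cy : DirectedCycleIn H (Monochromatic a)) → OneSided cy
    series-oneSided a = oneSided-if-separated separated
      where
      separated : ∀ {u v} → Monochromatic a u → Monochromatic a v → Left u → Right v → ⊥
      separated (Pu , refl) (_ , e) (x , refl) (y , refl) =
        <⇒≱ (subst (_< r₁) (sym (colour-left x)) (AcyclicColouringOn.colour-< C₁ x Pu))
            (subst (r₁ ≤_) (trans (sym (colour-right y)) e) (m≤m+n r₁ _))

    seriesColouring : AcyclicColouringOn (G₁ ⊗ G₂) P (r₁ + r₂)
    seriesColouring = colouring (m≤m+n r₁ r₂) ≤-refl series-oneSided

series-tight : ∀ {G₁ G₂} → HereditarilyTight G₁ → HereditarilyTight G₂ → HereditarilyTight (G₁ ⊗ G₂)
series-tight {G₁} {G₂} tight₁ tight₂ P P? with tight₁ _ (P? ∘ (_↑ˡ n G₂)) | tight₂ _ (P? ∘ (n G₁ ↑ʳ_))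
... | r₁ , K₁ , C₁ | r₂ , K₂ , C₂ = r₁ + r₂ , joinBiCliques P K₁ K₂ , seriesColouring P C₁ C₂

⊕⊆⊘ : ∀ G₁ G₂ u v → T (arc (G₁ ⊕ G₂) u v) → T (arc (G₁ ⊘ G₂) u v)
⊕⊆⊘ G₁ G₂ u v = strengthen (splitAt (n G₁) u) (splitAt (n G₁) v)
  where
  strengthen : ∀ s t → T (combine (arc G₁) (arc G₂) false false s t) → T (combine (arc G₁) (arc G₂) true false s t)
  strengthen (inj₁ _) (inj₁ _) = id
  strengthen (inj₂ _) (inj₂ _) = id
  strengthen (inj₁ _) (inj₂ _) ()
  strengthen (inj₂ _) (inj₁ _) ()

directedCograph-tight : ∀ {G} → DirectedCograph G → HereditarilyTight G
directedCograph-tight dc-single = single-tight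
directedCograph-tight (dc-union {G₁} {G₂} d₁ d₂) =
  directedUnion-tight ((λ _ _ → id) , ⊕⊆⊘ G₁ G₂) (directedCograph-tight d₁) (directedCograph-tight d₂)
directedCograph-tight (dc-series d₁ d₂) = series-tight (directedCograph-tight d₁) (directedCograph-tight d₂)
directedCograph-tight (dc-order {G₁} {G₂} d₁ d₂) =
  directedUnion-tight (⊕⊆⊘ G₁ G₂ , λ _ _ → id) (directedCograph-tight d₁) (directedCograph-tight d₂)

extDirectedCograph-tight : ∀ {G} → ExtDirectedCograph G → HereditarilyTight G
extDirectedCograph-tight edc-single = single-tight
extDirectedCograph-tight (edc-dunion d₁ d₂ union) =
  directedUnion-tight union (extDirectedCograph-tight d₁) (extDirectedCograph-tight d₂)
extDirectedCograph-tight (edc-series d₁ d₂) = series-tight (extDirectedCograph-tight d₁) (extDirectedCograph-tight d₂)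

proposition3p11 : (∀ G → DirectedCograph G → Perfect G)
    × (∀ G → ExtDirectedCograph G → Perfect G)
proposition3p11 = (λ _ → hereditarilyTight⇒perfect ∘ directedCograph-tight)
                , (λ _ → hereditarilyTight⇒perfect ∘ extDirectedCograph-tight)
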